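{- For every $\rho\in(0,1]$, every connected graph $G$ of order $n$ satisfies $h_{\rho}(G)=1$ or $h_{\rho}(G)<2\rho n$.
   Context: All graphs are finite and simple. For a graph $G$, a constant $\rho\in[0,1]$ and a set $A\subseteq V(G)$, define the infecting sequence by $A_0:=A$ and $A_{i+1}:=A_i\cup\{v\in V(G): |N_G(v)\cap A_i|\geq \rho\, d_G(v)\}$, where $N_G(v)$ is the neighbourhood and $d_G(v)$ the degree of $v$. Since $G$ is finite the sequence stabilises; the final set is denoted $H_{\rho,G}(A)$. A set $A$ is a contagious set for $G$ (with respect to $\rho$) if $H_{\rho,G}(A)=V(G)$. $h_{\rho}(G)$ denotes the minimum size of a contagious set for $G$ with respect to $\rho$.
   Formalization: The constant ρ ranges over the rationals in (0,1]. -}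

module Defs where

open import Data.Nat using (ℕ; zero; suc)
open import Data.Bool using (Bool; true; false)
open import Data.Fin using (Fin)
open import Data.Fin.Subset using (Subset; ⊤; ∣_∣; _∪_; _∩_)
open import Data.Vec using (tabulate)
open import Data.Integer using (+_)
open import Data.Rational using (ℚ; _/_; _*_; _≤_)
open import Data.Rational.Properties using (_≤?_)
open import Data.Product using (∃; _×_)
open import Relation.Nullary using (does)
open import Relation.Binary.PropositionalEquality using (_≡_)

⟦_⟧ : ℕ → ℚ
⟦ k ⟧ = + k / 1

record Graph (n : ℕ) : Set where
  field
    adj       : Fin n → Fin n → Bool
    symmetric : ∀ u v → adj u v ≡ adj v u
    irrefl    : ∀ v → adj v v ≡ false
open Graph public

N : ∀ {n} → Graph n → Fin n → Subset n
N G v = tabulate (λ u → adj G v u)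

deg : ∀ {n} → Graph n → Fin n → ℕ
deg G v = ∣ N G v ∣

data Reachable {n : ℕ} (G : Graph n) : Fin n → Fin n → Set where
  here : ∀ {v} → Reachable G v v
  step : ∀ {u w v} → adj G u w ≡ true → Reachable G w v → Reachable G u v

Connected : ∀ {n} → Graph n → Set
Connected G = ∀ u v → Reachable G u v

infectStep : ∀ {n} → ℚ → Graph n → Subset n → Subset n
infectStep ρ G A =
  A ∪ tabulate (λ v → does (ρ * ⟦ deg G v ⟧ ≤? ⟦ ∣ N G v ∩ A ∣ ⟧))

infectSeq : ∀ {n} → ℚ → Graph n → Subset n → ℕ → Subset n
infectSeq ρ G A zero    = A
infectSeq ρ G A (suc i) = infectStep ρ G (infectSeq ρ G A i)

-- A is contagious: H_{ρ,G}(A) = V(G), i.e. some A_i is all of V(G)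
-- (the sequence is increasing, so its final value is V(G) iff some term is)
Contagious : ∀ {n} → ℚ → Graph n → Subset n → Set
Contagious ρ G A = ∃ λ i → infectSeq ρ G A i ≡ ⊤

IsContagiousNumber : ∀ {n} → ℚ → Graph n → ℕ → Set
IsContagiousNumber ρ G k =
  (∃ λ A → Contagious ρ G A × ∣ A ∣ ≡ k) ×
  (∀ A → Contagious ρ G A → k Data.Nat.≤ ∣ A ∣)

{-# OPTIONS --safe #-}

-- Let t(v) = ⌈ρ d(v)⌉, the number of infected neighbours that infects v. An uninfected vertex v
-- with e infected neighbours gets the potential 2ρ if e = 0 and (t(v) − e)/(d(v) − e + 1)
-- otherwise; Φ(I) is the total potential outside the infected set I, so Φ(∅) = 2ρn. Grow I from a
-- single vertex x: a vertex the process would infect anyway joins for free, and Φ does not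
-- increase; if the process is stuck, connectivity gives an uninfected vertex with t ≥ 2, and
-- double counting the edges among such vertices shows that one of them lowers Φ by at least 1
-- when it joins, so it is added as a seed. Hence x and the seeds form a contagious set of size at
-- most 1 + Φ({x}). If t(x) ≥ 2, infecting x alone lowers Φ(∅) by more than 1, so this is < 2ρn;
-- if no vertex has t ≥ 2, no seed is ever needed and {x} is contagious.

module Submission where

open import Defs
open import Data.Nat using (ℕ; suc)
open import Data.Rational using (ℚ; 0ℚ; 1ℚ; _<_; _≤_; _*_)
open import Data.Sum as Sum using (_⊎_; inj₁; inj₂)
open import Relation.Binary.PropositionalEquality using (_≡_)

open import Data.Bool as Bool using (Bool; true; false; not; _∧_; _∨_)
open import Data.Fin using (Fin; zero; suc)
open import Data.Fin.Properties using (any?)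
open import Data.Fin.Subset using (Subset; ⊥; ⁅_⁆; _∪_; _∩_; ∣_∣; _∈_; _∉_; _⊆_; _⊂_; _⊃_; Nonempty)
open import Data.Fin.Subset.Induction using (Acc; acc; ⊃-wellFounded)
open import Data.Fin.Subset.Properties
  using ( x∈⁅x⁆; x∈⁅y⁆⇒x≡y; p⊆p∪q; q⊆p∪q; x∈p∪q⁺; x∈p∪q⁻; x∈p∩q⁺; x∈p∩q⁻; ⊆-antisym; ⊆⊤; ⊥⊆; Empty-unique
        ; ∣⁅x⁆∣≡1; ∣⊥∣≡0; ∣p∣≤∣x∷p∣; ∣p∩q∣≤∣p∣; p⊆q⇒∣p∣≤∣q∣; ∩-zeroʳ; ∪-identityˡ; ∪-identityʳ; ∪-assoc; ∪-comm )
open import Data.Vec using ([]; _∷_; lookup; tabulate)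
open import Data.Vec.Properties using (lookup-zipWith; lookup∘tabulate; lookup-replicate; []=⇒lookup; lookup⇒[]=)
open import Data.Bool.Properties using (∨-identityʳ; ¬-not)
open import Algebra.Bundles using (CommutativeRing)
open import Data.Nat as ℕ using (zero; z≤n; s≤s)
import Data.Nat.Properties as ℕ
import Data.Nat.Coprimality as Coprime
import Data.Integer as ℤ
import Data.Integer.Properties as ℤ
open import Data.Rational as ℚ using (mkℚ; *≤*; _+_; _-_; 1/_; NonZero; Positive; nonNegative; positive)
open import Data.Rational.Properties
open import Data.Rational.Solver using (module +-*-Solver)
open import Data.Product using (∃; _×_; _,_; proj₁; proj₂)
open import Function using (_⇔_; mk⇔; Equivalence; _∘_)
open import Relation.Nullary using (Dec; yes; no; does; ¬_; contradiction; _×-dec_)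
open import Relation.Nullary.Decidable using (dec-true)
open import Relation.Binary.PropositionalEquality
  using (_≢_; refl; sym; trans; cong; cong₂; subst; subst₂; module ≡-Reasoning)

open import Algebra.Properties.Semiring.Sum (CommutativeRing.semiring +-*-commutativeRing)
  using (sum-syntax; sum-cong-≗; ∑-comm; ∑-distrib-+; *-distribˡ-sum)
open +-*-Solver using (solve; _:+_; _:*_; _:-_; _:=_; con)
open import Algebra.Properties.Group +-0-group using () renaming (∙-cancelˡ to +-cancelˡ)

dec-true⁻¹ : ∀ {A : Set} (a? : Dec A) → does a? ≡ true → A
dec-true⁻¹ (yes a) _ = a

dec-false⁻¹ : ∀ {A : Set} (a? : Dec A) → does a? ≡ false → ¬ A
dec-false⁻¹ (no ¬a) _ = ¬a

*-nonNeg : ∀ {p q} → 0ℚ ≤ p → 0ℚ ≤ q → 0ℚ ≤ p * q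
*-nonNeg {p} {q} 0≤p 0≤q =
  nonNegative⁻¹ (p * q) {{nonNeg*nonNeg⇒nonNeg p {{nonNegative 0≤p}} q {{nonNegative 0≤q}}}}

p≤p+q : ∀ {p q} → 0ℚ ≤ q → p ≤ p + q
p≤p+q {p} {q} 0≤q = subst (_≤ p + q) (+-identityʳ p) (+-monoʳ-≤ p 0≤q)

q≤p+q : ∀ {p q} → 0ℚ ≤ p → q ≤ p + q
q≤p+q {p} {q} 0≤p = subst (_≤ p + q) (+-identityˡ q) (+-monoˡ-≤ q 0≤p)

p≤1⇒p*q≤q : ∀ {p q} → p ≤ 1ℚ → 0ℚ ≤ q → p * q ≤ q
p≤1⇒p*q≤q {p} {q} p≤1 0≤q = subst (p * q ≤_) (*-identityˡ q) (*-monoʳ-≤-nonNeg q {{nonNegative 0≤q}} p≤1)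

p≤q⇒0≤q-p : ∀ {p q} → p ≤ q → 0ℚ ≤ q - p
p≤q⇒0≤q-p {p} {q} p≤q = subst (_≤ q - p) (+-inverseʳ p) (+-monoˡ-≤ (ℚ.- p) p≤q)

⟦⟧≡mkℚ : ∀ k → ⟦ k ⟧ ≡ mkℚ (ℤ.+ k) 0 (Coprime.sym (Coprime.1-coprimeTo k))
⟦⟧≡mkℚ k = normalize-coprime (Coprime.sym (Coprime.1-coprimeTo k))

⟦⟧-+ : ∀ m n → ⟦ m ℕ.+ n ⟧ ≡ ⟦ m ⟧ + ⟦ n ⟧
⟦⟧-+ m n = trans
  (/-cong (trans (ℤ.pos-+ m n) (sym (cong₂ ℤ._+_ (ℤ.*-identityʳ (ℤ.+ m)) (ℤ.*-identityʳ (ℤ.+ n))))) refl)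
  (sym (cong₂ _+_ (⟦⟧≡mkℚ m) (⟦⟧≡mkℚ n)))

⟦⟧-* : ∀ m n → ⟦ m ℕ.* n ⟧ ≡ ⟦ m ⟧ * ⟦ n ⟧
⟦⟧-* m n = trans (/-cong (ℤ.pos-* m n) refl) (sym (cong₂ _*_ (⟦⟧≡mkℚ m) (⟦⟧≡mkℚ n)))

⟦⟧-nonNeg : ∀ k → 0ℚ ≤ ⟦ k ⟧
⟦⟧-nonNeg k = nonNegative⁻¹ ⟦ k ⟧ {{normalize-nonNeg k 1}}

⟦⟧-mono-≤ : ∀ {m n} → m ℕ.≤ n → ⟦ m ⟧ ≤ ⟦ n ⟧
⟦⟧-mono-≤ {m} {n} m≤n = subst (⟦ m ⟧ ≤_)
  (trans (sym (⟦⟧-+ m (n ℕ.∸ m))) (cong ⟦_⟧ (ℕ.m+[n∸m]≡n m≤n))) (p≤p+q (⟦⟧-nonNeg (n ℕ.∸ m)))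

⟦⟧-cancel-< : ∀ {m n} → ⟦ m ⟧ < ⟦ n ⟧ → m ℕ.< n
⟦⟧-cancel-< {m} {n} ⟦m⟧<⟦n⟧ = ℕ.≰⇒> (λ n≤m → <-irrefl refl (<-≤-trans ⟦m⟧<⟦n⟧ (⟦⟧-mono-≤ n≤m)))

⟦suc⟧-pos : ∀ k → Positive ⟦ suc k ⟧
⟦suc⟧-pos k = normalize-pos (suc k) 1

⟦suc⟧-nonZero : ∀ k → NonZero ⟦ suc k ⟧
⟦suc⟧-nonZero k = pos⇒nonZero ⟦ suc k ⟧ {{⟦suc⟧-pos k}}

1/⟦suc_⟧ : ℕ → ℚ
1/⟦suc k ⟧ = 1/_ ⟦ suc k ⟧ {{⟦suc⟧-nonZero k}}

frac : ℕ → ℕ → ℚ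
frac a b = ⟦ a ⟧ * 1/⟦suc b ⟧

frac-nonNeg : ∀ a b → 0ℚ ≤ frac a b
frac-nonNeg a b = *-nonNeg (⟦⟧-nonNeg a)
  (nonNegative⁻¹ 1/⟦suc b ⟧ {{pos⇒nonNeg 1/⟦suc b ⟧ {{1/pos⇒pos ⟦ suc b ⟧ {{⟦suc⟧-pos b}}}}}})

*-frac : ∀ a b → ⟦ suc b ⟧ * frac a b ≡ ⟦ a ⟧
*-frac a b = begin
  ⟦ suc b ⟧ * frac a b  ≡⟨ solve 3 (λ x y z → x :* (y :* z) := y :* (x :* z)) refl ⟦ suc b ⟧ ⟦ a ⟧ 1/⟦suc b ⟧ ⟩
  ⟦ a ⟧ * (⟦ suc b ⟧ * 1/⟦suc b ⟧)  ≡⟨ cong (⟦ a ⟧ *_) (*-inverseʳ ⟦ suc b ⟧ {{⟦suc⟧-nonZero b}}) ⟩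
  ⟦ a ⟧ * 1ℚ               ≡⟨ *-identityʳ ⟦ a ⟧ ⟩
  ⟦ a ⟧                    ∎
  where open ≡-Reasoning

frac-≤ : ∀ {a b q} → ⟦ a ⟧ ≤ q * ⟦ suc b ⟧ → frac a b ≤ q
frac-≤ {a} {b} {q} a≤qb = *-cancelˡ-≤-pos ⟦ suc b ⟧ {{⟦suc⟧-pos b}}
  (subst₂ _≤_ (sym (*-frac a b)) (*-comm q ⟦ suc b ⟧) a≤qb)

frac-cross-≤ : ∀ {a b c d} → a ℕ.* suc d ℕ.≤ c ℕ.* suc b → frac a b ≤ frac c d
frac-cross-≤ {a} {b} {c} {d} ad≤cb = *-cancelˡ-≤-pos (⟦ suc b ⟧ * ⟦ suc d ⟧)
  {{pos*pos⇒pos ⟦ suc b ⟧ {{⟦suc⟧-pos b}} ⟦ suc d ⟧ {{⟦suc⟧-pos d}}}} (begin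
    (⟦ suc b ⟧ * ⟦ suc d ⟧) * frac a b  ≡⟨ *-assoc ⟦ suc b ⟧ ⟦ suc d ⟧ (frac a b) ⟩
    ⟦ suc b ⟧ * (⟦ suc d ⟧ * frac a b)  ≡⟨ solve 3 (λ x y z → x :* (y :* z) := y :* (x :* z)) refl ⟦ suc b ⟧ ⟦ suc d ⟧ (frac a b) ⟩
    ⟦ suc d ⟧ * (⟦ suc b ⟧ * frac a b)  ≡⟨ cong (⟦ suc d ⟧ *_) (*-frac a b) ⟩
    ⟦ suc d ⟧ * ⟦ a ⟧                   ≡⟨ trans (*-comm ⟦ suc d ⟧ ⟦ a ⟧) (sym (⟦⟧-* a (suc d))) ⟩
    ⟦ a ℕ.* suc d ⟧                     ≤⟨ ⟦⟧-mono-≤ ad≤cb ⟩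
    ⟦ c ℕ.* suc b ⟧                     ≡⟨ trans (⟦⟧-* c (suc b)) (*-comm ⟦ c ⟧ ⟦ suc b ⟧) ⟩
    ⟦ suc b ⟧ * ⟦ c ⟧                   ≡⟨ cong (⟦ suc b ⟧ *_) (sym (*-frac c d)) ⟩
    ⟦ suc b ⟧ * (⟦ suc d ⟧ * frac c d)  ≡⟨ sym (*-assoc ⟦ suc b ⟧ ⟦ suc d ⟧ (frac c d)) ⟩
    (⟦ suc b ⟧ * ⟦ suc d ⟧) * frac c d  ∎)
  where open ≤-Reasoning

-- For q < 0 this pins t to 0, not to ⌈ q ⌉.
IsCeiling : ℚ → ℕ → Set
IsCeiling q t = ∀ k → t ℕ.≤ k ⇔ q ≤ ⟦ k ⟧

ceiling-exists : ∀ q b → q ≤ ⟦ b ⟧ → ∃ (IsCeiling q)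
ceiling-exists q zero q≤0 = 0 , λ k → mk⇔ (λ _ → ≤-trans q≤0 (⟦⟧-nonNeg k)) (λ _ → z≤n)
ceiling-exists q (suc b) q≤b+1 with q ≤? ⟦ b ⟧
... | yes q≤b = ceiling-exists q b q≤b
... | no  q≰b = suc b , λ k → mk⇔
  (λ b<k → ≤-trans q≤b+1 (⟦⟧-mono-≤ b<k))
  (λ q≤k → ⟦⟧-cancel-< (<-≤-trans (≰⇒> q≰b) q≤k))

module _ {q t} (t-ceil : IsCeiling q t) where

  ≤⇒ceiling≤ : ∀ {k} → q ≤ ⟦ k ⟧ → t ℕ.≤ k
  ≤⇒ceiling≤ {k} = Equivalence.from (t-ceil k)

  ceiling≤⇒≤ : ∀ {k} → t ℕ.≤ k → q ≤ ⟦ k ⟧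
  ceiling≤⇒≤ {k} = Equivalence.to (t-ceil k)

  <ceiling⇒< : ∀ {k} → k ℕ.< t → ⟦ k ⟧ < q
  <ceiling⇒< k<t = ≰⇒> (λ q≤k → ℕ.<⇒≱ k<t (≤⇒ceiling≤ q≤k))

⟦pred-ceiling⟧≤ : ∀ {q} t → IsCeiling q t → 0ℚ ≤ q → ⟦ ℕ.pred t ⟧ ≤ q
⟦pred-ceiling⟧≤ zero    _      0≤q = 0≤q
⟦pred-ceiling⟧≤ (suc s) t-ceil _   = <⇒≤ (<ceiling⇒< t-ceil ℕ.≤-refl)

-- The potential of a single vertex

suc[n∸suc[m]]≡n∸m : ∀ {m n} → m ℕ.< n → suc (n ℕ.∸ suc m) ≡ n ℕ.∸ m
suc[n∸suc[m]]≡n∸m m<n = sym (ℕ.+-∸-assoc 1 m<n)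

pred[m]*[2+n]≤m*[1+n] : ∀ {m n} → m ℕ.≤ suc n → ℕ.pred m ℕ.* suc (suc n) ℕ.≤ m ℕ.* suc n
pred[m]*[2+n]≤m*[1+n] {zero}  _   = z≤n
pred[m]*[2+n]≤m*[1+n] {suc m} {n} 1+m≤1+n = begin
  m ℕ.* suc (suc n)      ≡⟨ ℕ.*-suc m (suc n) ⟩
  m ℕ.+ m ℕ.* suc n      ≤⟨ ℕ.+-monoˡ-≤ (m ℕ.* suc n) (ℕ.m≤n⇒m≤1+n (ℕ.s≤s⁻¹ 1+m≤1+n)) ⟩
  suc n ℕ.+ m ℕ.* suc n  ∎
  where open ℕ.≤-Reasoning

module VertexPotential (ρ : ℚ) (0≤ρ : 0ℚ ≤ ρ) (ρ≤1 : ρ ≤ 1ℚ) (d t : ℕ) (t-ceil : IsCeiling (ρ * ⟦ d ⟧) t) where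

  F : ℕ → ℚ
  F zero    = ρ + ρ
  F (suc e) = frac (t ℕ.∸ suc e) (d ℕ.∸ suc e)

  Δ : ℕ → ℚ
  Δ e = F e - F (suc e)

  t≤d : t ℕ.≤ d
  t≤d = ≤⇒ceiling≤ t-ceil (p≤1⇒p*q≤q ρ≤1 (⟦⟧-nonNeg d))

  F-nonNeg : ∀ e → 0ℚ ≤ F e
  F-nonNeg zero    = +-mono-≤ 0≤ρ 0≤ρ
  F-nonNeg (suc e) = frac-nonNeg (t ℕ.∸ suc e) (d ℕ.∸ suc e)

  F[1]≤ρ : 1 ℕ.≤ d → F 1 ≤ ρ
  F[1]≤ρ 1≤d = frac-≤ {t ℕ.∸ 1} {d ℕ.∸ 1} (subst₂ (λ a b → ⟦ a ⟧ ≤ ρ * ⟦ b ⟧)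
    (ℕ.pred[m∸n]≡m∸[1+n] t 0) (sym (suc[n∸suc[m]]≡n∸m 1≤d))
    (⟦pred-ceiling⟧≤ t t-ceil (*-nonNeg 0≤ρ (⟦⟧-nonNeg d))))

  F-antitone : ∀ {e} → suc e ℕ.≤ d → F (suc e) ≤ F e
  F-antitone {zero}  1≤d = ≤-trans (F[1]≤ρ 1≤d) (p≤p+q 0≤ρ)
  F-antitone {suc e} e<d = subst₂ (λ a b → frac a (d ℕ.∸ suc (suc e)) ≤ frac (t ℕ.∸ suc e) b)
    (ℕ.pred[m∸n]≡m∸[1+n] t (suc e)) (suc[n∸suc[m]]≡n∸m e<d)
    (frac-cross-≤ {ℕ.pred (t ℕ.∸ suc e)} {d ℕ.∸ suc (suc e)} {t ℕ.∸ suc e} (pred[m]*[2+n]≤m*[1+n]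
      (subst (t ℕ.∸ suc e ℕ.≤_) (sym (suc[n∸suc[m]]≡n∸m e<d)) (ℕ.∸-monoˡ-≤ (suc e) t≤d))))

  F≤2ρ : ∀ {e} → e ℕ.≤ d → F e ≤ ρ + ρ
  F≤2ρ {zero}  _   = ≤-refl
  F≤2ρ {suc e} e<d = ≤-trans (F-antitone e<d) (F≤2ρ (ℕ.<⇒≤ e<d))

  Δ-nonNeg : ∀ {e} → suc e ℕ.≤ d → 0ℚ ≤ Δ e
  Δ-nonNeg e<d = p≤q⇒0≤q-p (F-antitone e<d)

  ρ≤Δ[0] : 1 ℕ.≤ d → ρ ≤ Δ 0
  ρ≤Δ[0] 1≤d = subst (_≤ Δ 0) (solve 1 (λ r → (r :+ r) :- r := r) refl ρ)
    (+-monoʳ-≤ (ρ + ρ) (neg-antimono-≤ (F[1]≤ρ 1≤d)))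

  Δ[0]≡2ρ : t ≡ 1 → Δ 0 ≡ ρ + ρ
  Δ[0]≡2ρ refl = solve 2 (λ r x → (r :+ r) :- con 0ℚ :* x := r :+ r) refl ρ 1/⟦suc d ℕ.∸ 1 ⟧

  neighbours-split : ∀ {e s} → e ℕ.≤ d → ⟦ e ⟧ + s ≡ ⟦ d ⟧ → s ≡ ⟦ d ℕ.∸ e ⟧
  neighbours-split {e} {s} e≤d split = +-cancelˡ ⟦ e ⟧ s ⟦ d ℕ.∸ e ⟧
    (trans split (trans (cong ⟦_⟧ (sym (ℕ.m+[n∸m]≡n e≤d))) (⟦⟧-+ e (d ℕ.∸ e))))

  -- h and ℓ stand for the numbers of uninfected neighbours with threshold ≥ 2 and ≤ 1; the right
  -- side is the vertex's share of the potential drop once it is double counted in ∑-budget≡∑-drop.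
  budget : ∀ {e h ℓ} → e ℕ.< t → 2 ℕ.≤ t → 0ℚ ≤ h → 0ℚ ≤ ℓ → ⟦ e ⟧ + (h + ℓ) ≡ ⟦ d ⟧ →
           1ℚ ≤ F e + Δ e * h + (ρ + ρ) * ℓ
  budget {zero} {h} {ℓ} _ 2≤t 0≤h 0≤ℓ split = begin
    1ℚ                           ≤⟨ <⇒≤ (<ceiling⇒< t-ceil 2≤t) ⟩
    ρ * ⟦ d ⟧                    ≡⟨ cong (ρ *_) (sym (neighbours-split z≤n split)) ⟩
    ρ * (h + ℓ)                  ≡⟨ *-distribˡ-+ ρ h ℓ ⟩
    ρ * h + ρ * ℓ                ≤⟨ +-mono-≤ (*-monoʳ-≤-nonNeg h {{nonNegative 0≤h}} (ρ≤Δ[0] 1≤d))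
                                             (*-monoʳ-≤-nonNeg ℓ {{nonNegative 0≤ℓ}} (p≤p+q {ρ} 0≤ρ)) ⟩
    Δ 0 * h + (ρ + ρ) * ℓ        ≤⟨ +-monoˡ-≤ ((ρ + ρ) * ℓ) (q≤p+q (F-nonNeg 0)) ⟩
    F 0 + Δ 0 * h + (ρ + ρ) * ℓ  ∎
    where
    open ≤-Reasoning
    1≤d : 1 ℕ.≤ d
    1≤d = ℕ.≤-trans (ℕ.≤-trans (s≤s z≤n) 2≤t) t≤d
  budget {suc e} {h} {ℓ} e<t _ 0≤h 0≤ℓ split = begin
    1ℚ                                     ≤⟨ p≤p+q (*-nonNeg 0≤ℓ slack) ⟩
    1ℚ + ℓ * ((ρ + ρ) - Δ (suc e))         ≡⟨ cong (_+ ℓ * ((ρ + ρ) - Δ (suc e))) telescope ⟨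
    ((1ℚ + s) * r₁ - s * r₂) + ℓ * ((ρ + ρ) - Δ (suc e))
      ≡⟨ solve 5 (λ r h ℓ r₁ r₂ → ((con 1ℚ :+ (h :+ ℓ)) :* r₁ :- (h :+ ℓ) :* r₂) :+ ℓ :* ((r :+ r) :- (r₁ :- r₂))
                                   := r₁ :+ (r₁ :- r₂) :* h :+ (r :+ r) :* ℓ) refl ρ h ℓ r₁ r₂ ⟩
    F (suc e) + Δ (suc e) * h + (ρ + ρ) * ℓ  ∎
    where
    open ≤-Reasoning
    s r₁ r₂ : ℚ
    s  = h + ℓ
    r₁ = F (suc e)
    r₂ = F (suc (suc e))
    e<d : suc e ℕ.< d
    e<d = ℕ.<-≤-trans e<t t≤d
    s≡ : s ≡ ⟦ suc (d ℕ.∸ suc (suc e)) ⟧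
    s≡ = trans (neighbours-split (ℕ.<⇒≤ e<d) split) (cong ⟦_⟧ (sym (suc[n∸suc[m]]≡n∸m e<d)))
    telescope : (1ℚ + s) * r₁ - s * r₂ ≡ 1ℚ
    telescope = begin-equality
      (1ℚ + s) * r₁ - s * r₂
        ≡⟨ cong₂ (λ a b → a * r₁ - b * r₂)
             (trans (cong (1ℚ +_) (neighbours-split (ℕ.<⇒≤ e<d) split)) (sym (⟦⟧-+ 1 (d ℕ.∸ suc e)))) s≡ ⟩
      ⟦ suc (d ℕ.∸ suc e) ⟧ * r₁ - ⟦ suc (d ℕ.∸ suc (suc e)) ⟧ * r₂
        ≡⟨ cong₂ _-_ (*-frac (t ℕ.∸ suc e) (d ℕ.∸ suc e)) (*-frac (t ℕ.∸ suc (suc e)) (d ℕ.∸ suc (suc e))) ⟩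
      ⟦ t ℕ.∸ suc e ⟧ - ⟦ t ℕ.∸ suc (suc e) ⟧
        ≡⟨ cong (λ k → ⟦ k ⟧ - ⟦ t ℕ.∸ suc (suc e) ⟧) (suc[n∸suc[m]]≡n∸m e<t) ⟨
      ⟦ suc (t ℕ.∸ suc (suc e)) ⟧ - ⟦ t ℕ.∸ suc (suc e) ⟧
        ≡⟨ cong (_- ⟦ t ℕ.∸ suc (suc e) ⟧) (⟦⟧-+ 1 (t ℕ.∸ suc (suc e))) ⟩
      (1ℚ + ⟦ t ℕ.∸ suc (suc e) ⟧) - ⟦ t ℕ.∸ suc (suc e) ⟧
        ≡⟨ solve 1 (λ x → (con 1ℚ :+ x) :- x := con 1ℚ) refl ⟦ t ℕ.∸ suc (suc e) ⟧ ⟩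
      1ℚ ∎
    slack : 0ℚ ≤ (ρ + ρ) - Δ (suc e)
    slack = subst (0ℚ ≤_) (solve 3 (λ r r₁ r₂ → ((r :+ r) :- r₁) :+ r₂ := (r :+ r) :- (r₁ :- r₂)) refl ρ r₁ r₂)
      (+-mono-≤ (p≤q⇒0≤q-p (F≤2ρ (ℕ.<⇒≤ e<d))) (F-nonNeg (suc (suc e))))

χ : Bool → ℚ
χ true  = 1ℚ
χ false = 0ℚ

χ-nonNeg : ∀ b → 0ℚ ≤ χ b
χ-nonNeg true  = *≤* (ℤ.+≤+ z≤n)
χ-nonNeg false = ≤-refl

χ-*-nonNeg : ∀ b {p} → (b ≡ true → 0ℚ ≤ p) → 0ℚ ≤ χ b * p
χ-*-nonNeg true  {p} 0≤p = subst (0ℚ ≤_) (sym (*-identityˡ p)) (0≤p refl)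
χ-*-nonNeg false {p} _ = ≤-reflexive (sym (*-zeroˡ p))

χ-*-mono-≤ : ∀ b {p q} → (b ≡ true → p ≤ q) → χ b * p ≤ χ b * q
χ-*-mono-≤ true  {p} {q} p≤q = subst₂ _≤_ (sym (*-identityˡ p)) (sym (*-identityˡ q)) (p≤q refl)
χ-*-mono-≤ false {p} {q} _ = ≤-reflexive (trans (*-zeroˡ p) (sym (*-zeroˡ q)))

∑-nonNeg : ∀ {n} {f : Fin n → ℚ} → (∀ i → 0ℚ ≤ f i) → 0ℚ ≤ ∑[ i < n ] f i
∑-nonNeg {zero}  _     = ≤-refl
∑-nonNeg {suc n} 0≤f = +-mono-≤ (0≤f zero) (∑-nonNeg (0≤f ∘ suc))

∑-mono-≤ : ∀ {n} {f g : Fin n → ℚ} → (∀ i → f i ≤ g i) → ∑[ i < n ] f i ≤ ∑[ i < n ] g i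
∑-mono-≤ {zero}  _   = ≤-refl
∑-mono-≤ {suc n} f≤g = +-mono-≤ (f≤g zero) (∑-mono-≤ (f≤g ∘ suc))

∑-mono-< : ∀ {n} {f g : Fin n → ℚ} → (∀ i → f i ≤ g i) → ∀ j → f j < g j → ∑[ i < n ] f i < ∑[ i < n ] g i
∑-mono-< {suc n} f≤g zero    fj<gj = +-mono-<-≤ fj<gj (∑-mono-≤ (f≤g ∘ suc))
∑-mono-< {suc n} f≤g (suc j) fj<gj = +-mono-≤-< (f≤g zero) (∑-mono-< (f≤g ∘ suc) j fj<gj)

∑-const : ∀ n c → ∑[ i < n ] c ≡ ⟦ n ⟧ * c
∑-const zero    c = sym (*-zeroˡ c)
∑-const (suc n) c = begin
  c + ∑[ i < n ] c      ≡⟨ cong (c +_) (∑-const n c) ⟩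
  c + ⟦ n ⟧ * c         ≡⟨ solve 2 (λ c m → c :+ m :* c := (con 1ℚ :+ m) :* c) refl c ⟦ n ⟧ ⟩
  (1ℚ + ⟦ n ⟧) * c      ≡⟨ cong (_* c) (⟦⟧-+ 1 n) ⟨
  ⟦ suc n ⟧ * c         ∎
  where open ≡-Reasoning

∑-swap-symmetric : ∀ {n} (K : Fin n → Fin n → ℚ) (f : Fin n → ℚ) → (∀ x y → K x y ≡ K y x) →
                   ∑[ x < n ] ∑[ y < n ] (K x y * f y) ≡ ∑[ x < n ] ∑[ y < n ] (K x y * f x)
∑-swap-symmetric {n} K f K-sym = trans (∑-comm (λ x y → K x y * f y))
  (sum-cong-≗ (λ y → sum-cong-≗ (λ x → cong (_* f y) (K-sym x y))))

∑-select : ∀ {n} (S : Fin n → Bool) (a b : Fin n → ℚ) → ∃ (λ j → S j ≡ true) →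
           ∑[ i < n ] (χ (S i) * a i) ≤ ∑[ i < n ] (χ (S i) * b i) →
           ∃ λ i → S i ≡ true × a i ≤ b i
∑-select {n} S a b (j , Sj) ∑a≤∑b with any? (λ i → (S i Bool.≟ true) ×-dec (a i ≤? b i))
... | yes found = found
... | no  none  = contradiction (<-≤-trans ∑b<∑a ∑a≤∑b) (<-irrefl refl)
  where
  b<a : ∀ {i} → S i ≡ true → b i < a i
  b<a {i} Si = ≰⇒> (λ ai≤bi → none (i , Si , ai≤bi))
  b≤a : ∀ i → χ (S i) * b i ≤ χ (S i) * a i
  b≤a i = χ-*-mono-≤ (S i) (<⇒≤ ∘ b<a)
  ∑b<∑a : ∑[ i < n ] (χ (S i) * b i) < ∑[ i < n ] (χ (S i) * a i)
  ∑b<∑a = ∑-mono-< b≤a j (subst (λ s → χ s * b j < χ s * a j) (sym Sj) (*-monoʳ-<-pos 1ℚ (b<a Sj)))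

lookup-∪ : ∀ {n} (p q : Subset n) v → lookup (p ∪ q) v ≡ lookup p v ∨ lookup q v
lookup-∪ p q v = lookup-zipWith _∨_ v p q

lookup-∩ : ∀ {n} (p q : Subset n) v → lookup (p ∩ q) v ≡ lookup p v ∧ lookup q v
lookup-∩ p q v = lookup-zipWith _∧_ v p q

lookup≡false⇒∉ : ∀ {n} {p : Subset n} {x} → lookup p x ≡ false → x ∉ p
lookup≡false⇒∉ px≡false x∈p with () ← trans (sym ([]=⇒lookup x∈p)) px≡false

p⊂p∪⁅x⁆ : ∀ {n} {p : Subset n} {x} → x ∉ p → p ⊂ p ∪ ⁅ x ⁆
p⊂p∪⁅x⁆ {x = x} x∉p = p⊆p∪q ⁅ x ⁆ , x , x∈p∪q⁺ (inj₂ (x∈⁅x⁆ x)) , x∉p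

Nonempty-∪ : ∀ {n} {p q : Subset n} → Nonempty p → Nonempty (p ∪ q)
Nonempty-∪ {q = q} (x , x∈p) = x , p⊆p∪q q x∈p

x∈p⇒1≤∣p∣ : ∀ {n} {p : Subset n} {x} → x ∈ p → 1 ℕ.≤ ∣ p ∣
x∈p⇒1≤∣p∣ {p = p} {x} x∈p = subst (ℕ._≤ ∣ p ∣) (∣⁅x⁆∣≡1 x)
  (p⊆q⇒∣p∣≤∣q∣ (λ y∈⁅x⁆ → subst (_∈ p) (sym (x∈⁅y⁆⇒x≡y x y∈⁅x⁆)) x∈p))

∣p∪q∣≤∣p∣+∣q∣ : ∀ {n} (p q : Subset n) → ∣ p ∪ q ∣ ℕ.≤ ∣ p ∣ ℕ.+ ∣ q ∣
∣p∪q∣≤∣p∣+∣q∣ []          []          = z≤n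
∣p∪q∣≤∣p∣+∣q∣ (true ∷ p)  (b ∷ q)     = s≤s (ℕ.≤-trans (∣p∪q∣≤∣p∣+∣q∣ p q) (ℕ.+-monoʳ-≤ ∣ p ∣ (∣p∣≤∣x∷p∣ b q)))
∣p∪q∣≤∣p∣+∣q∣ (false ∷ p) (true ∷ q)  = ℕ.≤-trans (s≤s (∣p∪q∣≤∣p∣+∣q∣ p q)) (ℕ.≤-reflexive (sym (ℕ.+-suc ∣ p ∣ ∣ q ∣)))
∣p∪q∣≤∣p∣+∣q∣ (false ∷ p) (false ∷ q) = ∣p∪q∣≤∣p∣+∣q∣ p q

p∩[q∪⁅x⁆]≡p∩q : ∀ {n} (p q : Subset n) x → lookup p x ≡ false → p ∩ (q ∪ ⁅ x ⁆) ≡ p ∩ q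
p∩[q∪⁅x⁆]≡p∩q (false ∷ p) (b ∷ q) zero    _  = cong (λ r → false ∷ p ∩ r) (∪-identityʳ q)
p∩[q∪⁅x⁆]≡p∩q (a ∷ p)     (b ∷ q) (suc x) px =
  cong₂ _∷_ (cong (a ∧_) (∨-identityʳ b)) (p∩[q∪⁅x⁆]≡p∩q p q x px)

∣p∩[q∪⁅x⁆]∣≡1+∣p∩q∣ : ∀ {n} (p q : Subset n) x → lookup p x ≡ true → lookup q x ≡ false →
                      ∣ p ∩ (q ∪ ⁅ x ⁆) ∣ ≡ suc ∣ p ∩ q ∣
∣p∩[q∪⁅x⁆]∣≡1+∣p∩q∣ (true ∷ p) (false ∷ q) zero    _  _  = cong (λ r → suc ∣ p ∩ r ∣) (∪-identityʳ q)
∣p∩[q∪⁅x⁆]∣≡1+∣p∩q∣ (a ∷ p)    (b ∷ q)     (suc x) px qx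
  rewrite ∨-identityʳ b with a ∧ b
... | true  = cong suc (∣p∩[q∪⁅x⁆]∣≡1+∣p∩q∣ p q x px qx)
... | false = ∣p∩[q∪⁅x⁆]∣≡1+∣p∩q∣ p q x px qx

∑-χ : ∀ {n} (p : Subset n) → ∑[ v < n ] χ (lookup p v) ≡ ⟦ ∣ p ∣ ⟧
∑-χ []          = refl
∑-χ (true ∷ p)  = trans (cong (1ℚ +_) (∑-χ p)) (sym (⟦⟧-+ 1 ∣ p ∣))
∑-χ (false ∷ p) = trans (+-identityˡ _) (∑-χ p)

∑-χ⊥ : ∀ {n} (f : Fin n → ℚ) → ∑[ v < n ] (χ (lookup ⊥ v) * f v) ≡ 0ℚ
∑-χ⊥ {zero}  f = refl
∑-χ⊥ {suc n} f = cong₂ _+_ (*-zeroˡ (f zero)) (∑-χ⊥ (f ∘ suc))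

∑-χ⁅x⁆ : ∀ {n} (x : Fin n) (f : Fin n → ℚ) → ∑[ v < n ] (χ (lookup ⁅ x ⁆ v) * f v) ≡ f x
∑-χ⁅x⁆ zero    f = trans (cong₂ _+_ (*-identityˡ (f zero)) (∑-χ⊥ (f ∘ suc))) (+-identityʳ (f zero))
∑-χ⁅x⁆ (suc x) f = trans (cong₂ _+_ (*-zeroˡ (f zero)) (∑-χ⁅x⁆ x (f ∘ suc))) (+-identityˡ (f (suc x)))

-- The infection process

module Infection (ρ : ℚ) {n} (G : Graph n) where

  Ready : Subset n → Fin n → Set
  Ready A v = ρ * ⟦ deg G v ⟧ ≤ ⟦ ∣ N G v ∩ A ∣ ⟧

  Ready-mono : ∀ {A B v} → A ⊆ B → Ready A v → Ready B v
  Ready-mono {A} {B} {v} A⊆B ready = ≤-trans ready (⟦⟧-mono-≤ (p⊆q⇒∣p∣≤∣q∣ N∩A⊆N∩B))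
    where
    N∩A⊆N∩B : N G v ∩ A ⊆ N G v ∩ B
    N∩A⊆N∩B x∈ = let x∈N , x∈A = x∈p∩q⁻ (N G v) A x∈ in x∈p∩q⁺ (x∈N , A⊆B x∈A)

  Ready? : ∀ A v → Dec (Ready A v)
  Ready? A v = ρ * ⟦ deg G v ⟧ ≤? ⟦ ∣ N G v ∩ A ∣ ⟧

  newly : Subset n → Subset n
  newly A = tabulate (λ v → does (Ready? A v))

  ∈-infectStep⁺ : ∀ {A v} → Ready A v → v ∈ infectStep ρ G A
  ∈-infectStep⁺ {A} {v} ready = x∈p∪q⁺ {p = A} {q = newly A} (inj₂ (lookup⇒[]= v (newly A)
    (trans (lookup∘tabulate (λ w → does (Ready? A w)) v) (dec-true (Ready? A v) ready))))

  ∈-infectStep⁻ : ∀ {A v} → v ∈ infectStep ρ G A → v ∈ A ⊎ Ready A v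
  ∈-infectStep⁻ {A} {v} v∈ = Sum.map₂ (λ v∈T → dec-true⁻¹ (Ready? A v)
    (trans (sym (lookup∘tabulate (λ w → does (Ready? A w)) v)) ([]=⇒lookup v∈T))) (x∈p∪q⁻ A (newly A) v∈)

  infectStep-inflationary : ∀ {A} → A ⊆ infectStep ρ G A
  infectStep-inflationary = p⊆p∪q _

  infectStep-mono : ∀ {A B} → A ⊆ B → infectStep ρ G A ⊆ infectStep ρ G B
  infectStep-mono A⊆B v∈ =
    Sum.[ (λ v∈A → infectStep-inflationary (A⊆B v∈A)) , (λ ready → ∈-infectStep⁺ (Ready-mono A⊆B ready)) ]
      (∈-infectStep⁻ v∈)

  infectSeq-mono : ∀ {A B} → A ⊆ B → ∀ i → infectSeq ρ G A i ⊆ infectSeq ρ G B i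
  infectSeq-mono A⊆B zero    = A⊆B
  infectSeq-mono A⊆B (suc i) = infectStep-mono (infectSeq-mono A⊆B i)

  infectSeq-infectStep : ∀ A i → infectSeq ρ G (infectStep ρ G A) i ≡ infectSeq ρ G A (suc i)
  infectSeq-infectStep A zero    = refl
  infectSeq-infectStep A (suc i) = cong (infectStep ρ G) (infectSeq-infectStep A i)

  Contagious-mono : ∀ {A B} → A ⊆ B → Contagious ρ G A → Contagious ρ G B
  Contagious-mono A⊆B (i , Aᵢ≡⊤) = i , ⊆-antisym ⊆⊤ (subst (_⊆ _) Aᵢ≡⊤ (infectSeq-mono A⊆B i))

  Contagious-infectStep : ∀ {A} → Contagious ρ G (infectStep ρ G A) → Contagious ρ G A
  Contagious-infectStep {A} (i , eq) = suc i , trans (sym (infectSeq-infectStep A i)) eq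

-- The potential of an infected set

-- The term of a vertex v in potential-split: i = [v ∈ I], s = [v = x], a = [x ~ v], and f e is
-- the potential of v with e infected neighbours.
potential-term-split : ∀ (f : ℕ → ℚ) {e e′} i s a →
  (s ≡ true → i ≡ false × a ≡ false) → (a ≡ true → e′ ≡ suc e) → (a ≡ false → e′ ≡ e) →
  χ (not i) * f e ≡ χ (not (i ∨ s)) * f e′ + (χ s * f e + χ a * (χ (not i) * (f e - f (suc e))))
potential-term-split f {e} i true a v=x _ _ with v=x refl
... | refl , refl = solve 3 (λ x y z → con 1ℚ :* x := con 0ℚ :* y :+ (con 1ℚ :* x :+ con 0ℚ :* (con 1ℚ :* z)))
  refl (f e) (f _) (f e - f (suc e))
potential-term-split f {e} i false true _ x~v _ rewrite x~v refl | ∨-identityʳ i =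
  solve 3 (λ c x y → c :* x := c :* y :+ (con 0ℚ :* x :+ con 1ℚ :* (c :* (x :- y)))) refl (χ (not i)) (f e) (f (suc e))
potential-term-split f {e} i false false _ _ x≁v rewrite x≁v refl | ∨-identityʳ i =
  solve 3 (λ c x y → c :* x := c :* x :+ (con 0ℚ :* x :+ con 0ℚ :* (c :* (x :- y)))) refl (χ (not i)) (f e) (f (suc e))

module Potential (ρ : ℚ) (0<ρ : 0ℚ < ρ) (ρ≤1 : ρ ≤ 1ℚ) {n} (G : Graph n) where

  0≤ρ : 0ℚ ≤ ρ
  0≤ρ = <⇒≤ 0<ρ

  threshold-exists : ∀ v → ∃ (IsCeiling (ρ * ⟦ deg G v ⟧))
  threshold-exists v = ceiling-exists (ρ * ⟦ deg G v ⟧) (deg G v) (p≤1⇒p*q≤q ρ≤1 (⟦⟧-nonNeg (deg G v)))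

  opaque
    threshold : Fin n → ℕ
    threshold v = proj₁ (threshold-exists v)

    threshold-isCeiling : ∀ v → IsCeiling (ρ * ⟦ deg G v ⟧) (threshold v)
    threshold-isCeiling v = proj₂ (threshold-exists v)

  module V (v : Fin n) = VertexPotential ρ 0≤ρ ρ≤1 (deg G v) (threshold v) (threshold-isCeiling v)

  degIn : Subset n → Fin n → ℕ
  degIn I v = ∣ N G v ∩ I ∣

  F Δ : Subset n → Fin n → ℚ
  F I v = V.F v (degIn I v)
  Δ I v = V.Δ v (degIn I v)

  potential : Subset n → ℚ
  potential I = ∑[ v < n ] (χ (not (lookup I v)) * F I v)

  drop : Subset n → Fin n → ℚ
  drop I x = F I x + ∑[ v < n ] (χ (adj G x v) * (χ (not (lookup I v)) * Δ I v))

  lookup-N : ∀ v w → lookup (N G v) w ≡ adj G v w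
  lookup-N v = lookup∘tabulate (adj G v)

  degIn≤deg : ∀ I v → degIn I v ℕ.≤ deg G v
  degIn≤deg I v = ∣p∩q∣≤∣p∣ (N G v) I

  degIn-∪⁅⁆-adj : ∀ {I v x} → adj G v x ≡ true → lookup I x ≡ false → degIn (I ∪ ⁅ x ⁆) v ≡ suc (degIn I v)
  degIn-∪⁅⁆-adj {I} {v} {x} vx Ix = ∣p∩[q∪⁅x⁆]∣≡1+∣p∩q∣ (N G v) I x (trans (lookup-N v x) vx) Ix

  degIn-∪⁅⁆-nonadj : ∀ {I v x} → adj G v x ≡ false → degIn (I ∪ ⁅ x ⁆) v ≡ degIn I v
  degIn-∪⁅⁆-nonadj {I} {v} {x} ¬vx = cong ∣_∣ (p∩[q∪⁅x⁆]≡p∩q (N G v) I x (trans (lookup-N v x) ¬vx))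

  potential-split-at : ∀ {I x} → lookup I x ≡ false → ∀ v →
    χ (not (lookup I v)) * F I v ≡
    χ (not (lookup (I ∪ ⁅ x ⁆) v)) * F (I ∪ ⁅ x ⁆) v +
      (χ (lookup ⁅ x ⁆ v) * F I v + χ (adj G x v) * (χ (not (lookup I v)) * Δ I v))
  potential-split-at {I} {x} Ix v = trans
    (potential-term-split (V.F v) (lookup I v) (lookup ⁅ x ⁆ v) (adj G x v) v∈⁅x⁆⇒ x~v⇒ x≁v⇒)
    (cong (λ b → χ (not b) * F (I ∪ ⁅ x ⁆) v +
                 (χ (lookup ⁅ x ⁆ v) * F I v + χ (adj G x v) * (χ (not (lookup I v)) * Δ I v)))
          (sym (lookup-∪ I ⁅ x ⁆ v)))
    where
    v∈⁅x⁆⇒ : lookup ⁅ x ⁆ v ≡ true → lookup I v ≡ false × adj G x v ≡ false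
    v∈⁅x⁆⇒ v∈⁅x⁆ = subst (λ w → lookup I w ≡ false × adj G x w ≡ false)
      (sym (x∈⁅y⁆⇒x≡y x (lookup⇒[]= v ⁅ x ⁆ v∈⁅x⁆))) (Ix , irrefl G x)
    x~v⇒ : adj G x v ≡ true → degIn (I ∪ ⁅ x ⁆) v ≡ suc (degIn I v)
    x~v⇒ xv = degIn-∪⁅⁆-adj (trans (symmetric G v x) xv) Ix
    x≁v⇒ : adj G x v ≡ false → degIn (I ∪ ⁅ x ⁆) v ≡ degIn I v
    x≁v⇒ xv = degIn-∪⁅⁆-nonadj (trans (symmetric G v x) xv)

  potential-split : ∀ {I x} → lookup I x ≡ false → potential I ≡ potential (I ∪ ⁅ x ⁆) + drop I x
  potential-split {I} {x} Ix = begin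
    potential I                              ≡⟨ sum-cong-≗ (potential-split-at {I} {x} Ix) ⟩
    ∑[ v < n ] (a v + (b v + c v))           ≡⟨ ∑-distrib-+ a (λ v → b v + c v) ⟩
    ∑[ v < n ] a v + ∑[ v < n ] (b v + c v)  ≡⟨ cong (∑[ v < n ] a v +_) (∑-distrib-+ b c) ⟩
    ∑[ v < n ] a v + (∑[ v < n ] b v + ∑[ v < n ] c v)
      ≡⟨ cong (λ z → ∑[ v < n ] a v + (z + ∑[ v < n ] c v)) (∑-χ⁅x⁆ x (F I)) ⟩
    potential (I ∪ ⁅ x ⁆) + drop I x ∎
    where
    open ≡-Reasoning
    a b c : Fin n → ℚ
    a v = χ (not (lookup (I ∪ ⁅ x ⁆) v)) * F (I ∪ ⁅ x ⁆) v
    b v = χ (lookup ⁅ x ⁆ v) * F I v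
    c v = χ (adj G x v) * (χ (not (lookup I v)) * Δ I v)

  drop-nonNeg : ∀ {I x} → lookup I x ≡ false → 0ℚ ≤ drop I x
  drop-nonNeg {I} {x} Ix = +-mono-≤ (V.F-nonNeg x (degIn I x)) (∑-nonNeg (λ v →
    χ-*-nonNeg (adj G x v) (λ xv → χ-*-nonNeg (not (lookup I v)) (λ _ → V.Δ-nonNeg v (room v xv)))))
    where
    room : ∀ v → adj G x v ≡ true → suc (degIn I v) ℕ.≤ deg G v
    room v xv = subst (ℕ._≤ deg G v) (degIn-∪⁅⁆-adj (trans (symmetric G v x) xv) Ix) (degIn≤deg (I ∪ ⁅ x ⁆) v)

  potential-antitone : ∀ {I x} → lookup I x ≡ false → potential (I ∪ ⁅ x ⁆) ≤ potential I
  potential-antitone {I} {x} Ix =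
    subst (potential (I ∪ ⁅ x ⁆) ≤_) (sym (potential-split {I} {x} Ix)) (p≤p+q (drop-nonNeg {I} {x} Ix))

  potential-nonNeg : ∀ I → 0ℚ ≤ potential I
  potential-nonNeg I = ∑-nonNeg (λ v → *-nonNeg (χ-nonNeg (not (lookup I v))) (V.F-nonNeg v (degIn I v)))

  degIn-⊥ : ∀ v → degIn ⊥ v ≡ 0
  degIn-⊥ v = trans (cong ∣_∣ (∩-zeroʳ (N G v))) (∣⊥∣≡0 n)

  potential-⊥ : potential ⊥ ≡ ⟦ n ⟧ * (ρ + ρ)
  potential-⊥ = trans (sum-cong-≗ uninfected) (∑-const n (ρ + ρ))
    where
    uninfected : ∀ v → χ (not (lookup ⊥ v)) * F ⊥ v ≡ ρ + ρ
    uninfected v = trans (cong (λ b → χ (not b) * F ⊥ v) (lookup-replicate v false))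
                         (trans (*-identityˡ (F ⊥ v)) (cong (V.F v) (degIn-⊥ v)))

  drop-⊥ : ∀ {x} → 2 ℕ.≤ threshold x → 1ℚ < drop ⊥ x
  drop-⊥ {x} 2≤t = begin-strict
    1ℚ                              <⟨ <ceiling⇒< (threshold-isCeiling x) 2≤t ⟩
    ρ * ⟦ deg G x ⟧                 ≡⟨ cong (ρ *_) (trans (sym (∑-χ (N G x))) (sum-cong-≗ (cong χ ∘ lookup-N x))) ⟩
    ρ * ∑[ v < n ] χ (adj G x v)    ≡⟨ *-distribˡ-sum ρ (χ ∘ adj G x) ⟩
    ∑[ v < n ] (ρ * χ (adj G x v))  ≤⟨ ∑-mono-≤ ρ≤term ⟩
    ∑[ v < n ] (χ (adj G x v) * (χ (not (lookup ⊥ v)) * Δ ⊥ v))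
                                    ≤⟨ q≤p+q (V.F-nonNeg x (degIn ⊥ x)) ⟩
    drop ⊥ x                        ∎
    where
    open ≤-Reasoning
    x∈N : ∀ v → adj G x v ≡ true → x ∈ N G v
    x∈N v xv = lookup⇒[]= x (N G v) (trans (lookup-N v x) (trans (symmetric G v x) xv))
    ρ≤term : ∀ v → ρ * χ (adj G x v) ≤ χ (adj G x v) * (χ (not (lookup ⊥ v)) * Δ ⊥ v)
    ρ≤term v = subst (_≤ χ (adj G x v) * (χ (not (lookup ⊥ v)) * Δ ⊥ v)) (*-comm (χ (adj G x v)) ρ)
      (χ-*-mono-≤ (adj G x v) (λ xv →
        subst (ρ ≤_) (sym (trans (cong (λ b → χ (not b) * Δ ⊥ v) (lookup-replicate v false)) (*-identityˡ (Δ ⊥ v))))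
          (subst (λ e → ρ ≤ V.Δ v e) (sym (degIn-⊥ v)) (V.ρ≤Δ[0] v (x∈p⇒1≤∣p∣ (x∈N v xv))))))

  high : Fin n → Bool
  high v = does (2 ℕ.≤? threshold v)

  highOutside lowOutside : Subset n → Fin n → Bool
  highOutside I v = not (lookup I v) ∧ high v
  lowOutside  I v = not (lookup I v) ∧ not (high v)

  Closed : Subset n → Set
  Closed I = ∀ v → lookup I v ≡ false → degIn I v ℕ.< threshold v

  highDeg lowDeg : Subset n → Fin n → ℚ
  highDeg I x = ∑[ v < n ] (χ (adj G x v) * χ (highOutside I v))
  lowDeg  I x = ∑[ v < n ] (χ (adj G x v) * χ (lowOutside I v))

  highOutside⇒ : ∀ {I v} → highOutside I v ≡ true → lookup I v ≡ false × 2 ℕ.≤ threshold v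
  highOutside⇒ {I} {v} Sv with lookup I v | high v in hv
  ... | false | true = refl , dec-true⁻¹ (2 ℕ.≤? threshold v) hv

  lowOutside⇒ : ∀ {I v} → Closed I → lowOutside I v ≡ true → degIn I v ≡ 0 × threshold v ≡ 1
  lowOutside⇒ {I} {v} closed Lv with lookup I v in Iv | high v in hv
  ... | false | false = ℕ.n<1⇒n≡0 (ℕ.<-≤-trans e<t t≤1) , ℕ.≤-antisym t≤1 (ℕ.≤-trans (s≤s z≤n) e<t)
    where
    t≤1 : threshold v ℕ.≤ 1
    t≤1 = ℕ.s≤s⁻¹ (ℕ.≰⇒> (dec-false⁻¹ (2 ℕ.≤? threshold v) hv))
    e<t : degIn I v ℕ.< threshold v
    e<t = closed v Iv

  Δ-lowOutside : ∀ {I v} → Closed I → lowOutside I v ≡ true → Δ I v ≡ ρ + ρ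
  Δ-lowOutside {I} {v} closed Lv =
    let e≡0 , t≡1 = lowOutside⇒ closed Lv in trans (cong (V.Δ v) e≡0) (V.Δ[0]≡2ρ v t≡1)

  drop-closed : ∀ {I} → Closed I → ∀ x →
    drop I x ≡ F I x + (∑[ v < n ] (χ (adj G x v) * (χ (highOutside I v) * Δ I v)) + (ρ + ρ) * lowDeg I x)
  drop-closed {I} closed x = cong (F I x +_) (begin
    ∑[ v < n ] (χ (adj G x v) * (χ (not (lookup I v)) * Δ I v))
      ≡⟨ sum-cong-≗ (λ v → outside-split (lookup I v) (high v) {adj G x v} (Δ-lowOutside {I} {v} closed)) ⟩
    ∑[ v < n ] (h v + (ρ + ρ) * l v)          ≡⟨ ∑-distrib-+ h (λ v → (ρ + ρ) * l v) ⟩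
    ∑[ v < n ] h v + ∑[ v < n ] ((ρ + ρ) * l v) ≡⟨ cong (∑[ v < n ] h v +_) (*-distribˡ-sum (ρ + ρ) l) ⟨
    ∑[ v < n ] h v + (ρ + ρ) * lowDeg I x     ∎)
    where
    open ≡-Reasoning
    h l : Fin n → ℚ
    h v = χ (adj G x v) * (χ (highOutside I v) * Δ I v)
    l v = χ (adj G x v) * χ (lowOutside I v)
    outside-split : ∀ i h {a D} → (not i ∧ not h ≡ true → D ≡ ρ + ρ) →
      χ a * (χ (not i) * D) ≡ χ a * (χ (not i ∧ h) * D) + (ρ + ρ) * (χ a * χ (not i ∧ not h))
    outside-split true  h     {a} {D} _ =
      solve 3 (λ x d c → x :* (con 0ℚ :* d) := x :* (con 0ℚ :* d) :+ c :* (x :* con 0ℚ)) refl (χ a) D (ρ + ρ)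
    outside-split false true  {a} {D} _ =
      solve 3 (λ x d c → x :* (con 1ℚ :* d) := x :* (con 1ℚ :* d) :+ c :* (x :* con 0ℚ)) refl (χ a) D (ρ + ρ)
    outside-split false false {a} {D} D≡2ρ rewrite D≡2ρ refl =
      solve 2 (λ x c → x :* (con 1ℚ :* c) := x :* (con 0ℚ :* c) :+ c :* (x :* con 1ℚ)) refl (χ a) (ρ + ρ)

  degIn-partition : ∀ I x → ⟦ degIn I x ⟧ + (highDeg I x + lowDeg I x) ≡ ⟦ deg G x ⟧
  degIn-partition I x = begin
    ⟦ degIn I x ⟧ + (highDeg I x + lowDeg I x)
      ≡⟨ cong (_+ (highDeg I x + lowDeg I x)) (trans (sym (∑-χ (N G x ∩ I))) (sum-cong-≗ lookup-N∩)) ⟩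
    ∑[ v < n ] e v + (∑[ v < n ] h v + ∑[ v < n ] l v) ≡⟨ cong (∑[ v < n ] e v +_) (∑-distrib-+ h l) ⟨
    ∑[ v < n ] e v + ∑[ v < n ] (h v + l v)           ≡⟨ ∑-distrib-+ e (λ v → h v + l v) ⟨
    ∑[ v < n ] (e v + (h v + l v))                    ≡⟨ sum-cong-≗ (λ v → χ-partition (adj G x v) (lookup I v) (high v)) ⟩
    ∑[ v < n ] χ (adj G x v)                          ≡⟨ trans (sym (sum-cong-≗ (cong χ ∘ lookup-N x))) (∑-χ (N G x)) ⟩
    ⟦ deg G x ⟧                                       ∎
    where
    open ≡-Reasoning
    e h l : Fin n → ℚ
    e v = χ (adj G x v ∧ lookup I v)
    h v = χ (adj G x v) * χ (highOutside I v)
    l v = χ (adj G x v) * χ (lowOutside I v)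
    lookup-N∩ : ∀ v → χ (lookup (N G x ∩ I) v) ≡ e v
    lookup-N∩ v = cong χ (trans (lookup-∩ (N G x) I v) (cong (_∧ lookup I v) (lookup-N x v)))
    χ-partition : ∀ a i h → χ (a ∧ i) + (χ a * χ (not i ∧ h) + χ a * χ (not i ∧ not h)) ≡ χ a
    χ-partition true  true  true  = refl
    χ-partition true  true  false = refl
    χ-partition true  false true  = refl
    χ-partition true  false false = refl
    χ-partition false true  true  = refl
    χ-partition false true  false = refl
    χ-partition false false true  = refl
    χ-partition false false false = refl

  budget-at : ∀ {I x} → Closed I → highOutside I x ≡ true →
              1ℚ ≤ F I x + Δ I x * highDeg I x + (ρ + ρ) * lowDeg I x
  budget-at {I} {x} closed Sx =
    let Ix , 2≤t = highOutside⇒ {I} {x} Sx in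
    V.budget x (closed x Ix) 2≤t
      (∑-nonNeg (λ v → *-nonNeg (χ-nonNeg (adj G x v)) (χ-nonNeg (highOutside I v))))
      (∑-nonNeg (λ v → *-nonNeg (χ-nonNeg (adj G x v)) (χ-nonNeg (lowOutside I v))))
      (degIn-partition I x)

  -- Summing drop over the high uninfected vertices counts each edge between two of them from
  -- both ends; this exchange turns the total into the sum of the per-vertex budgets.
  ∑-budget≡∑-drop : ∀ {I} → Closed I →
    ∑[ x < n ] (χ (highOutside I x) * (F I x + Δ I x * highDeg I x + (ρ + ρ) * lowDeg I x)) ≡
    ∑[ x < n ] (χ (highOutside I x) * drop I x)
  ∑-budget≡∑-drop {I} closed = begin
    ∑[ x < n ] (χ (S x) * (F I x + Δ I x * highDeg I x + (ρ + ρ) * lowDeg I x))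
      ≡⟨ sum-cong-≗ budget-split ⟩
    ∑[ x < n ] (g x + ∑[ v < n ] (K x v * Δ I x))
      ≡⟨ ∑-distrib-+ g (λ x → ∑[ v < n ] (K x v * Δ I x)) ⟩
    ∑[ x < n ] g x + ∑[ x < n ] ∑[ v < n ] (K x v * Δ I x)
      ≡⟨ cong (∑[ x < n ] g x +_) (∑-swap-symmetric K (Δ I) K-sym) ⟨
    ∑[ x < n ] g x + ∑[ x < n ] ∑[ v < n ] (K x v * Δ I v)
      ≡⟨ ∑-distrib-+ g (λ x → ∑[ v < n ] (K x v * Δ I v)) ⟨
    ∑[ x < n ] (g x + ∑[ v < n ] (K x v * Δ I v))
      ≡⟨ sum-cong-≗ drop-split ⟨
    ∑[ x < n ] (χ (S x) * drop I x) ∎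
    where
    open ≡-Reasoning
    S : Fin n → Bool
    S = highOutside I
    K : Fin n → Fin n → ℚ
    K x v = χ (S x) * (χ (adj G x v) * χ (S v))
    K-sym : ∀ x v → K x v ≡ K v x
    K-sym x v = trans (solve 3 (λ p q r → p :* (q :* r) := r :* (q :* p)) refl (χ (S x)) (χ (adj G x v)) (χ (S v)))
                      (cong (λ b → χ (S v) * (χ b * χ (S x))) (symmetric G x v))
    g : Fin n → ℚ
    g x = χ (S x) * (F I x + (ρ + ρ) * lowDeg I x)
    budget-split : ∀ x → χ (S x) * (F I x + Δ I x * highDeg I x + (ρ + ρ) * lowDeg I x) ≡
                         g x + ∑[ v < n ] (K x v * Δ I x)
    budget-split x = begin
      χ (S x) * (F I x + Δ I x * highDeg I x + (ρ + ρ) * lowDeg I x)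
        ≡⟨ solve 6 (λ s f d h c l → s :* (f :+ d :* h :+ c :* l) := s :* (f :+ c :* l) :+ (s :* d) :* h) refl
             (χ (S x)) (F I x) (Δ I x) (highDeg I x) (ρ + ρ) (lowDeg I x) ⟩
      g x + (χ (S x) * Δ I x) * highDeg I x
        ≡⟨ cong (g x +_) (*-distribˡ-sum (χ (S x) * Δ I x) (λ v → χ (adj G x v) * χ (S v))) ⟩
      g x + ∑[ v < n ] ((χ (S x) * Δ I x) * (χ (adj G x v) * χ (S v)))
        ≡⟨ cong (g x +_) (sum-cong-≗ (λ v → solve 4 (λ s d a t → (s :* d) :* (a :* t) := (s :* (a :* t)) :* d) refl
             (χ (S x)) (Δ I x) (χ (adj G x v)) (χ (S v)))) ⟩
      g x + ∑[ v < n ] (K x v * Δ I x) ∎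
    drop-split : ∀ x → χ (S x) * drop I x ≡ g x + ∑[ v < n ] (K x v * Δ I v)
    drop-split x = begin
      χ (S x) * drop I x
        ≡⟨ cong (χ (S x) *_) (drop-closed closed x) ⟩
      χ (S x) * (F I x + (∑[ v < n ] (χ (adj G x v) * (χ (S v) * Δ I v)) + (ρ + ρ) * lowDeg I x))
        ≡⟨ solve 5 (λ s f e c l → s :* (f :+ (e :+ c :* l)) := s :* (f :+ c :* l) :+ s :* e) refl
             (χ (S x)) (F I x) (∑[ v < n ] (χ (adj G x v) * (χ (S v) * Δ I v))) (ρ + ρ) (lowDeg I x) ⟩
      g x + χ (S x) * ∑[ v < n ] (χ (adj G x v) * (χ (S v) * Δ I v))
        ≡⟨ cong (g x +_) (*-distribˡ-sum (χ (S x)) (λ v → χ (adj G x v) * (χ (S v) * Δ I v))) ⟩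
      g x + ∑[ v < n ] (χ (S x) * (χ (adj G x v) * (χ (S v) * Δ I v)))
        ≡⟨ cong (g x +_) (sum-cong-≗ (λ v → solve 4 (λ s a t d → s :* (a :* (t :* d)) := (s :* (a :* t)) :* d) refl
             (χ (S x)) (χ (adj G x v)) (χ (S v)) (Δ I v))) ⟩
      g x + ∑[ v < n ] (K x v * Δ I v) ∎

  closed⇒drop≥1 : ∀ {I} → Closed I → ∃ (λ x → highOutside I x ≡ true) →
                  ∃ λ x → highOutside I x ≡ true × 1ℚ ≤ drop I x
  closed⇒drop≥1 {I} closed nonempty = ∑-select (highOutside I) (λ _ → 1ℚ) (drop I) nonempty (begin
    ∑[ x < n ] (χ (highOutside I x) * 1ℚ)
      ≤⟨ ∑-mono-≤ (λ x → χ-*-mono-≤ (highOutside I x) (budget-at closed)) ⟩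
    ∑[ x < n ] (χ (highOutside I x) * (F I x + Δ I x * highDeg I x + (ρ + ρ) * lowDeg I x))
      ≡⟨ ∑-budget≡∑-drop closed ⟩
    ∑[ x < n ] (χ (highOutside I x) * drop I x) ∎)
    where open ≤-Reasoning

-- Choosing the seeds

crossing-edge : ∀ {n} {G : Graph n} (I : Subset n) {u w} → Reachable G u w → lookup I u ≡ true → lookup I w ≡ false →
                ∃ λ a → ∃ λ b → lookup I a ≡ true × lookup I b ≡ false × adj G a b ≡ true
crossing-edge I here              Iu Iw with () ← trans (sym Iu) Iw
crossing-edge I (step {u} {m} um r) Iu Iw with lookup I m in Im
... | true  = crossing-edge I r Im Iw
... | false = u , m , Iu , Im , um

module Seeds (ρ : ℚ) (0<ρ : 0ℚ < ρ) (ρ≤1 : ρ ≤ 1ℚ) {n} (G : Graph n) (connected : Connected G) where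

  open Infection ρ G
  open Potential ρ 0<ρ ρ≤1 G

  High : Subset n
  High = tabulate high

  ∈-High⁺ : ∀ {v} → high v ≡ true → v ∈ High
  ∈-High⁺ {v} hv = lookup⇒[]= v High (trans (lookup∘tabulate high v) hv)

  ∈-High⁻ : ∀ {v} → v ∈ High → high v ≡ true
  ∈-High⁻ {v} v∈High = trans (sym (lookup∘tabulate high v)) ([]=⇒lookup v∈High)

  -- B ⊆ High forces B = ⊥ when every threshold is at most 1.
  SeedsFor : Subset n → Set
  SeedsFor I = ∃ λ B → ⟦ ∣ B ∣ ⟧ ≤ potential I × B ⊆ High × Contagious ρ G (I ∪ B)

  seeds-full : ∀ {I} → (∀ v → lookup I v ≡ true) → SeedsFor I
  seeds-full {I} all-in = ⊥ , subst (_≤ potential I) (cong ⟦_⟧ (sym (∣⊥∣≡0 n))) (potential-nonNeg I) , ⊥⊆ ,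
    (0 , trans (∪-identityʳ I) (⊆-antisym ⊆⊤ (λ {v} _ → lookup⇒[]= v I (all-in v))))

  seeds-free : ∀ {I y} → lookup I y ≡ false → threshold y ℕ.≤ degIn I y → SeedsFor (I ∪ ⁅ y ⁆) → SeedsFor I
  seeds-free {I} {y} Iy t≤e (B , bound , B⊆High , contagious) =
    B , ≤-trans bound (potential-antitone {I} {y} Iy) , B⊆High , Contagious-infectStep (Contagious-mono next contagious)
    where
    y-ready : Ready (I ∪ B) y
    y-ready = Ready-mono (p⊆p∪q B) (ceiling≤⇒≤ (threshold-isCeiling y) t≤e)
    next : (I ∪ ⁅ y ⁆) ∪ B ⊆ infectStep ρ G (I ∪ B)
    next v∈ = Sum.[ Sum.[ (λ v∈I → infectStep-inflationary (p⊆p∪q B v∈I)) , y∈next ] ∘ x∈p∪q⁻ I ⁅ y ⁆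
                  , (λ v∈B → infectStep-inflationary (q⊆p∪q I B v∈B)) ]
              (x∈p∪q⁻ (I ∪ ⁅ y ⁆) B v∈)
      where
      y∈next : ∀ {v} → v ∈ ⁅ y ⁆ → v ∈ infectStep ρ G (I ∪ B)
      y∈next v∈⁅y⁆ = subst (_∈ infectStep ρ G (I ∪ B)) (sym (x∈⁅y⁆⇒x≡y y v∈⁅y⁆)) (∈-infectStep⁺ y-ready)

  seeds-paid : ∀ {I x} → lookup I x ≡ false → high x ≡ true → 1ℚ ≤ drop I x → SeedsFor (I ∪ ⁅ x ⁆) → SeedsFor I
  seeds-paid {I} {x} Ix hx 1≤drop (B , bound , B⊆High , contagious) =
    B ∪ ⁅ x ⁆ , bound′ , B∪⁅x⁆⊆High ,
    subst (Contagious ρ G) (trans (∪-assoc I ⁅ x ⁆ B) (cong (I ∪_) (∪-comm ⁅ x ⁆ B))) contagious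
    where
    bound′ : ⟦ ∣ B ∪ ⁅ x ⁆ ∣ ⟧ ≤ potential I
    bound′ = begin
      ⟦ ∣ B ∪ ⁅ x ⁆ ∣ ⟧                  ≤⟨ ⟦⟧-mono-≤ (subst (∣ B ∪ ⁅ x ⁆ ∣ ℕ.≤_) (cong (∣ B ∣ ℕ.+_) (∣⁅x⁆∣≡1 x))
                                                               (∣p∪q∣≤∣p∣+∣q∣ B ⁅ x ⁆)) ⟩
      ⟦ ∣ B ∣ ℕ.+ 1 ⟧                    ≡⟨ ⟦⟧-+ ∣ B ∣ 1 ⟩
      ⟦ ∣ B ∣ ⟧ + 1ℚ                     ≤⟨ +-mono-≤ bound 1≤drop ⟩
      potential (I ∪ ⁅ x ⁆) + drop I x   ≡⟨ potential-split Ix ⟨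
      potential I                        ∎
      where open ≤-Reasoning
    B∪⁅x⁆⊆High : B ∪ ⁅ x ⁆ ⊆ High
    B∪⁅x⁆⊆High v∈ = Sum.[ B⊆High , (λ v∈⁅x⁆ → subst (_∈ High) (sym (x∈⁅y⁆⇒x≡y x v∈⁅x⁆)) (∈-High⁺ hx)) ]
                           (x∈p∪q⁻ B ⁅ x ⁆ v∈)

  frontier : ∀ {I w} → Nonempty I → lookup I w ≡ false → Closed I → ∃ λ b → highOutside I b ≡ true
  frontier {I} {w} (u , u∈I) Iw closed =
    let a , b , Ia , Ib , ab = crossing-edge I (connected u w) ([]=⇒lookup u∈I) Iw
        1≤e = x∈p⇒1≤∣p∣ (x∈p∩q⁺ (lookup⇒[]= a (N G b) (trans (lookup-N b a) (trans (symmetric G b a) ab)) ,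
                                 lookup⇒[]= a I Ia))
    in b , cong₂ (λ i h → not i ∧ h) Ib (dec-true (2 ℕ.≤? threshold b) (ℕ.<-≤-trans (s≤s 1≤e) (closed b Ib)))

  seeds : ∀ I → Acc _⊃_ I → Nonempty I → SeedsFor I
  seeds I (acc rec) nonempty with any? (λ v → lookup I v Bool.≟ false)
  ... | no  none      = seeds-full (λ v → ¬-not (λ Iv → none (v , Iv)))
  ... | yes (w , Iw) with any? (λ y → (lookup I y Bool.≟ false) ×-dec (threshold y ℕ.≤? degIn I y))
  ...   | yes (y , Iy , t≤e) =
    seeds-free Iy t≤e (seeds (I ∪ ⁅ y ⁆) (rec (p⊂p∪⁅x⁆ (lookup≡false⇒∉ Iy))) (Nonempty-∪ nonempty))
  ...   | no  none          =
    let x , Sx , 1≤drop = closed⇒drop≥1 closed (frontier nonempty Iw closed)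
        Ix , 2≤t = highOutside⇒ {I} {x} Sx
    in seeds-paid {I} {x} Ix (dec-true (2 ℕ.≤? threshold x) 2≤t) 1≤drop
         (seeds (I ∪ ⁅ x ⁆) (rec (p⊂p∪⁅x⁆ (lookup≡false⇒∉ Ix))) (Nonempty-∪ nonempty))
    where
    closed : Closed I
    closed v Iv = ℕ.≰⇒> (λ t≤e → none (v , Iv , t≤e))

  seeds-from : ∀ x → SeedsFor (⊥ ∪ ⁅ x ⁆)
  seeds-from x = seeds (⊥ ∪ ⁅ x ⁆) (⊃-wellFounded (⊥ ∪ ⁅ x ⁆)) (x , x∈p∪q⁺ (inj₂ (x∈⁅x⁆ x)))

  ∣[⊥∪⁅x⁆]∪B∣≤1+∣B∣ : ∀ x (B : Subset n) → ∣ (⊥ ∪ ⁅ x ⁆) ∪ B ∣ ℕ.≤ 1 ℕ.+ ∣ B ∣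
  ∣[⊥∪⁅x⁆]∪B∣≤1+∣B∣ x B = subst (λ k → ∣ (⊥ ∪ ⁅ x ⁆) ∪ B ∣ ℕ.≤ k ℕ.+ ∣ B ∣)
    (trans (cong ∣_∣ (∪-identityˡ ⁅ x ⁆)) (∣⁅x⁆∣≡1 x)) (∣p∪q∣≤∣p∣+∣q∣ (⊥ ∪ ⁅ x ⁆) B)

  contagious-<2ρn : ∀ {x} → high x ≡ true → ∃ λ A → Contagious ρ G A × ⟦ ∣ A ∣ ⟧ < ⟦ 2 ⟧ * ρ * ⟦ n ⟧
  contagious-<2ρn {x} hx with seeds-from x
  ... | B , bound , _ , contagious = (⊥ ∪ ⁅ x ⁆) ∪ B , contagious , (begin-strict
    ⟦ ∣ (⊥ ∪ ⁅ x ⁆) ∪ B ∣ ⟧           ≤⟨ ⟦⟧-mono-≤ (∣[⊥∪⁅x⁆]∪B∣≤1+∣B∣ x B) ⟩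
    ⟦ 1 ℕ.+ ∣ B ∣ ⟧                   ≡⟨ ⟦⟧-+ 1 ∣ B ∣ ⟩
    1ℚ + ⟦ ∣ B ∣ ⟧                    ≤⟨ +-monoʳ-≤ 1ℚ bound ⟩
    1ℚ + potential (⊥ ∪ ⁅ x ⁆)        <⟨ +-monoˡ-< _ (drop-⊥ (dec-true⁻¹ (2 ℕ.≤? threshold x) hx)) ⟩
    drop ⊥ x + potential (⊥ ∪ ⁅ x ⁆)  ≡⟨ +-comm (drop ⊥ x) (potential (⊥ ∪ ⁅ x ⁆)) ⟩
    potential (⊥ ∪ ⁅ x ⁆) + drop ⊥ x  ≡⟨ potential-split {⊥} {x} (lookup-replicate x false) ⟨
    potential ⊥                       ≡⟨ potential-⊥ ⟩
    ⟦ n ⟧ * (ρ + ρ)                   ≡⟨ solve 2 (λ m r → m :* (r :+ r) := (con 1ℚ :+ con 1ℚ) :* r :* m) refl ⟦ n ⟧ ρ ⟩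
    ⟦ 2 ⟧ * ρ * ⟦ n ⟧                 ∎)
    where open ≤-Reasoning

  contagious-≤1 : (∀ x → high x ≢ true) → Fin n → ∃ λ A → Contagious ρ G A × ∣ A ∣ ℕ.≤ 1
  contagious-≤1 no-high x = let B , _ , B⊆High , contagious = seeds-from x in
    (⊥ ∪ ⁅ x ⁆) ∪ B , contagious , ℕ.≤-trans (∣[⊥∪⁅x⁆]∪B∣≤1+∣B∣ x B) (ℕ.+-monoʳ-≤ 1 (begin
      ∣ B ∣      ≤⟨ p⊆q⇒∣p∣≤∣q∣ {p = B} {q = High} B⊆High ⟩
      ∣ High ∣   ≡⟨ cong ∣_∣ (Empty-unique {p = High} (λ (v , v∈High) → no-high v (∈-High⁻ v∈High))) ⟩
      ∣ ⊥ {n} ∣ ≡⟨ ∣⊥∣≡0 n ⟩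
      0          ∎))
    where open ℕ.≤-Reasoning

  small-contagious-set : Fin n → (∃ λ A → Contagious ρ G A × ⟦ ∣ A ∣ ⟧ < ⟦ 2 ⟧ * ρ * ⟦ n ⟧)
                                ⊎ (∃ λ A → Contagious ρ G A × ∣ A ∣ ℕ.≤ 1)
  small-contagious-set x₀ with any? (λ x → high x Bool.≟ true)
  ... | yes (x , hx) = inj₁ (contagious-<2ρn hx)
  ... | no  no-high  = inj₂ (contagious-≤1 (λ x hx → no-high (x , hx)) x₀)

≤1⇒≡1⊎< : ∀ {h q} → 0ℚ < q → h ℕ.≤ 1 → h ≡ 1 ⊎ ⟦ h ⟧ < q
≤1⇒≡1⊎< {zero}     0<q _ = inj₂ 0<q
≤1⇒≡1⊎< {suc zero} _   _ = inj₁ refl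
≤1⇒≡1⊎< {suc (suc h)} _ (s≤s ())

theorem1 : (ρ : ℚ) → 0ℚ < ρ → ρ ≤ 1ℚ →
    (n : ℕ) → (G : Graph (suc n)) → Connected G →
    (h : ℕ) → IsContagiousNumber ρ G h →
    h ≡ 1 ⊎ ⟦ h ⟧ < ⟦ 2 ⟧ * ρ * ⟦ suc n ⟧
theorem1 ρ 0<ρ ρ≤1 n G connected h (_ , minimal) with Seeds.small-contagious-set ρ 0<ρ ρ≤1 G connected zero
... | inj₁ (A , contagious , ∣A∣<2ρn) = inj₂ (≤-<-trans (⟦⟧-mono-≤ (minimal A contagious)) ∣A∣<2ρn)
... | inj₂ (A , contagious , ∣A∣≤1)  = ≤1⇒≡1⊎< 0<2ρn (ℕ.≤-trans (minimal A contagious) ∣A∣≤1)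
  where
  0<2ρn : 0ℚ < ⟦ 2 ⟧ * ρ * ⟦ suc n ⟧
  0<2ρn = positive⁻¹ _ {{pos*pos⇒pos (⟦ 2 ⟧ * ρ) {{pos*pos⇒pos ⟦ 2 ⟧ {{⟦suc⟧-pos 1}} ρ {{positive 0<ρ}}}}
                                     ⟦ suc n ⟧ {{⟦suc⟧-pos n}}}}
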